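{- Let $B$ be an adequate Bézout domain and $I$ a nonzero weakly prime ideal of $B$. Then $I$ is contained in a unique maximal ideal of $B$; in particular $B/I$ is a valuation ring (possibly with zero divisors).
   Context: A Bézout domain is a commutative domain in which every 2-generated ideal is principal. $B$ is adequate if for all nonzero non-invertible $a,b\in B$ there is a factorization $a=cd$ with $\gcd(c,b)=1$ such that every non-invertible divisor $d'$ of $d$ is not coprime to $b$ (i.e. $d'B+bB\neq B$). A proper ideal $I$ is weakly prime if $B\setminus I$ is closed under least common multiples. A valuation ring is a commutative ring whose ideals are linearly ordered by inclusion. -}

module Defs where

open import Level using (Level; _⊔_)
open import Algebra.Bundles using (CommutativeRing)
open import Algebra.Structures using (IsCommutativeRing; IsRing; IsAbelianGroup; IsGroup; IsMonoid; IsSemigroup; IsMagma)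
open import Data.Product using (Σ; ∃; ∃₂; _×_; _,_; proj₁; proj₂)
open import Data.Sum using (_⊎_)
open import Relation.Nullary using (¬_)
open import Relation.Unary using (Pred; _⊆_; _∈_; _∉_)
open import Relation.Binary using (Rel)
import Algebra.Properties.Ring as RingProps
import Algebra.Properties.AbelianGroup as AbGProps
import Algebra.Properties.CommutativeSemigroup as CSProps
import Relation.Binary.Reasoning.Setoid as SetoidReasoning

module _ {c ℓ} (R : CommutativeRing c ℓ) where
  open CommutativeRing R

  Divides : Carrier → Carrier → Set (c ⊔ ℓ)
  Divides a b = ∃ λ k → k * a ≈ b

  Invertible : Carrier → Set (c ⊔ ℓ)
  Invertible a = ∃ λ u → u * a ≈ 1#

  GcdOne : Carrier → Carrier → Set (c ⊔ ℓ)
  GcdOne a b = ∀ e → Divides e a → Divides e b → Invertible e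

  Comaximal : Carrier → Carrier → Set (c ⊔ ℓ)
  Comaximal a b = ∃₂ λ s t → s * a + t * b ≈ 1#

  IsLcm : Carrier → Carrier → Carrier → Set (c ⊔ ℓ)
  IsLcm a b m = Divides a m × Divides b m × (∀ n → Divides a n → Divides b n → Divides m n)

  record IsIdeal (I : Pred Carrier (c ⊔ ℓ)) : Set (c ⊔ ℓ) where
    field
      ∈-resp-≈ : ∀ {x y} → x ≈ y → I x → I y
      0∈       : I 0#
      +-closed : ∀ {x y} → I x → I y → I (x + y)
      *-closed : ∀ r {x} → I x → I (r * x)

  Proper : Pred Carrier (c ⊔ ℓ) → Set (c ⊔ ℓ)
  Proper I = ¬ (1# ∈ I)

  IsProperIdeal : Pred Carrier (c ⊔ ℓ) → Set (c ⊔ ℓ)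
  IsProperIdeal I = IsIdeal I × Proper I

  IsMaximalIdeal : Pred Carrier (c ⊔ ℓ) → Set (Level.suc (c ⊔ ℓ))
  IsMaximalIdeal M = IsProperIdeal M ×
    (∀ (J : Pred Carrier (c ⊔ ℓ)) → IsProperIdeal J → M ⊆ J → J ⊆ M)

  NonzeroIdeal : Pred Carrier (c ⊔ ℓ) → Set (c ⊔ ℓ)
  NonzeroIdeal I = ∃ λ x → x ∈ I × ¬ (x ≈ 0#)

  IsWeaklyPrime : Pred Carrier (c ⊔ ℓ) → Set (c ⊔ ℓ)
  IsWeaklyPrime I = IsProperIdeal I ×
    (∀ a b m → IsLcm a b m → a ∉ I → b ∉ I → m ∉ I)

  IsDomain : Set (c ⊔ ℓ)
  IsDomain = ¬ (1# ≈ 0#) × (∀ a b → a * b ≈ 0# → a ≈ 0# ⊎ b ≈ 0#)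

  -- every 2-generated ideal aR + bR is principal (= dR)
  IsBezout : Set (c ⊔ ℓ)
  IsBezout = ∀ a b → ∃ λ d → ∀ x →
    ((∃₂ λ s t → s * a + t * b ≈ x) → Divides d x) ×
    (Divides d x → ∃₂ λ s t → s * a + t * b ≈ x)

  IsAdequate : Set (c ⊔ ℓ)
  IsAdequate = ∀ a b → ¬ (a ≈ 0#) → ¬ Invertible a → ¬ (b ≈ 0#) → ¬ Invertible b →
    ∃₂ λ c' d → (a ≈ c' * d) × GcdOne c' b ×
      (∀ d' → Divides d' d → ¬ Invertible d' → ¬ Comaximal d' b)

  IsAdequateBezoutDomain : Set (c ⊔ ℓ)
  IsAdequateBezoutDomain = IsDomain × IsBezout × IsAdequate

  IsValuationRing : Set (Level.suc (c ⊔ ℓ))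
  IsValuationRing = ∀ (J K : Pred Carrier (c ⊔ ℓ)) → IsIdeal J → IsIdeal K → J ⊆ K ⊎ K ⊆ J

-- The quotient ring R / I, as a setoid-based commutative ring:
-- same carrier and operations, equality  x ≈ᴵ y  iff  x - y ∈ I.

module QuotientConstruction {c ℓ} (R : CommutativeRing c ℓ)
       (I : Pred (CommutativeRing.Carrier R) (c ⊔ ℓ)) (isI : IsIdeal R I) where
  open CommutativeRing R
  open IsIdeal isI
  open RingProps ring using (-1*x≈-x; -‿involutive; -‿distribˡ-*; -‿distribʳ-*)
  open AbGProps +-abelianGroup using (⁻¹-∙-comm)
  open CSProps +-commutativeSemigroup using (interchange)
  open SetoidReasoning setoid

  infix 4 _≈ᴵ_
  _≈ᴵ_ : Rel Carrier (c ⊔ ℓ)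
  x ≈ᴵ y = I (x - y)

  neg∈ : ∀ {x} → I x → I (- x)
  neg∈ {x} p = ∈-resp-≈ (-1*x≈-x x) (*-closed (- 1#) p)

  lift : ∀ {x y} → x ≈ y → x ≈ᴵ y
  lift {x} {y} eq = ∈-resp-≈ (sym (trans (+-congʳ eq) (-‿inverseʳ y))) 0∈

  symᴵ : ∀ {x y} → x ≈ᴵ y → y ≈ᴵ x
  symᴵ {x} {y} p = ∈-resp-≈ eq (neg∈ p)
    where
    eq : - (x - y) ≈ y - x
    eq = begin
      - (x + - y)     ≈⟨ sym (⁻¹-∙-comm x (- y)) ⟩
      - x + - - y     ≈⟨ +-comm (- x) (- - y) ⟩
      - - y + - x     ≈⟨ +-congʳ (-‿involutive y) ⟩
      y + - x         ∎

  cancel : ∀ a b d → (a - b) + (b - d) ≈ a - d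
  cancel a b d = begin
    (a + - b) + (b + - d)   ≈⟨ +-assoc a (- b) (b + - d) ⟩
    a + (- b + (b + - d))   ≈⟨ +-congˡ (sym (+-assoc (- b) b (- d))) ⟩
    a + ((- b + b) + - d)   ≈⟨ +-congˡ (+-congʳ (-‿inverseˡ b)) ⟩
    a + (0# + - d)          ≈⟨ +-congˡ (+-identityˡ (- d)) ⟩
    a + - d                 ∎

  transᴵ : ∀ {x y z} → x ≈ᴵ y → y ≈ᴵ z → x ≈ᴵ z
  transᴵ {x} {y} {z} p q = ∈-resp-≈ (cancel x y z) (+-closed p q)

  +-congᴵ : ∀ {x y u v} → x ≈ᴵ y → u ≈ᴵ v → (x + u) ≈ᴵ (y + v)
  +-congᴵ {x} {y} {u} {v} p q = ∈-resp-≈ eq (+-closed p q)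
    where
    eq : (x - y) + (u - v) ≈ (x + u) - (y + v)
    eq = begin
      (x + - y) + (u + - v)   ≈⟨ interchange x (- y) u (- v) ⟩
      (x + u) + (- y + - v)   ≈⟨ +-congˡ (⁻¹-∙-comm y v) ⟩
      (x + u) + - (y + v)     ∎

  *-congᴵ : ∀ {x y u v} → x ≈ᴵ y → u ≈ᴵ v → (x * u) ≈ᴵ (y * v)
  *-congᴵ {x} {y} {u} {v} p q =
    ∈-resp-≈ eq (+-closed (∈-resp-≈ (*-comm u (x - y)) (*-closed u p)) (*-closed y q))
    where
    eq : (x - y) * u + y * (u - v) ≈ x * u - y * v
    eq = begin
      (x + - y) * u + y * (u + - v)
        ≈⟨ +-cong (distribʳ u x (- y)) (distribˡ y u (- v)) ⟩
      (x * u + - y * u) + (y * u + y * - v)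
        ≈⟨ +-cong (+-congˡ (sym (-‿distribˡ-* y u))) (+-congˡ (sym (-‿distribʳ-* y v))) ⟩
      (x * u - y * u) + (y * u - y * v)
        ≈⟨ cancel (x * u) (y * u) (y * v) ⟩
      x * u - y * v ∎

  -‿congᴵ : ∀ {x y} → x ≈ᴵ y → (- x) ≈ᴵ (- y)
  -‿congᴵ {x} {y} p = ∈-resp-≈ (sym (⁻¹-∙-comm x (- y))) (neg∈ p)

  isCommutativeRingᴵ : IsCommutativeRing _≈ᴵ_ _+_ _*_ -_ 0# 1#
  isCommutativeRingᴵ = record
    { isRing = record
      { +-isAbelianGroup = record
        { isGroup = record
          { isMonoid = record
            { isSemigroup = record
              { isMagma = record
                { isEquivalence = record
                  { refl = lift refl ; sym = symᴵ ; trans = transᴵ }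
                ; ∙-cong = +-congᴵ }
              ; assoc = λ x y z → lift (+-assoc x y z) }
            ; identity = (λ x → lift (+-identityˡ x)) , (λ x → lift (+-identityʳ x)) }
          ; inverse = (λ x → lift (-‿inverseˡ x)) , (λ x → lift (-‿inverseʳ x))
          ; ⁻¹-cong = -‿congᴵ }
        ; comm = λ x y → lift (+-comm x y) }
      ; *-cong = *-congᴵ
      ; *-assoc = λ x y z → lift (*-assoc x y z)
      ; *-identity = (λ x → lift (*-identityˡ x)) , (λ x → lift (*-identityʳ x))
      ; distrib = (λ x y z → lift (distribˡ x y z)) , (λ x y z → lift (distribʳ x y z)) }
    ; *-comm = λ x y → lift (*-comm x y) }

_/_ : ∀ {c ℓ} (R : CommutativeRing c ℓ)
      → (I : Σ (Pred (CommutativeRing.Carrier R) (c ⊔ ℓ)) (IsIdeal R))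
      → CommutativeRing c (c ⊔ ℓ)
R / (I , isI) = record { isCommutativeRing = QuotientConstruction.isCommutativeRingᴵ R I isI }

-- Classical principle used as an explicit hypothesis:
-- Krull's theorem (a consequence of Zorn's lemma) for the ring R:
-- every proper ideal is contained in some maximal ideal.

KrullProperty : ∀ {c ℓ} (R : CommutativeRing c ℓ) → Set (Level.suc (c ⊔ ℓ))
KrullProperty R = ∀ I → IsProperIdeal R I → ∃ λ M → IsMaximalIdeal R M × I ⊆ M

-- Let M₁, M₂ be proper ideals over I with m₁ + m₂ = 1, mᵢ ∈ Mᵢ, and let 0 ≠ a ∈ I.
-- Adequacy splits a = c d with c comaximal to m₁ and no nonunit divisor of d
-- comaximal to m₁; then c and d are comaximal, so a = lcm(c, d) and weak primeness
-- puts c or d into I. But c ∈ I ⊆ M₁ is impossible, and d ∈ I ⊆ M₂ makes gcd(d, m₂)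
-- a nonunit divisor of d comaximal to m₁. So I lies in a unique maximal ideal M.
-- For the valuation property write x = x' g, y = y' g with x', y' comaximal
-- (g = gcd(x, y), cancelled in the domain); one of x', y' lies outside M, hence is
-- a unit modulo I, and then it divides the other one modulo I.

module Submission where

open import Defs
open import Level using (_⊔_)
open import Algebra.Bundles using (CommutativeRing)
open import Axiom.ExcludedMiddle using (ExcludedMiddle)
open import Data.Product using (∃; ∃₂; _×_; _,_; proj₁; proj₂)
open import Data.Sum using (_⊎_; inj₁; inj₂; [_,_]′)
open import Data.Empty using (⊥-elim)
open import Relation.Nullary using (¬_; yes; no)
open import Relation.Nullary.Decidable using (decidable-stable)
open import Relation.Unary using (Pred; _⊆_)
import Algebra.Properties.Ring as RingProperties
import Algebra.Properties.CommutativeSemigroup as CommutativeSemigroupProperties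
import Relation.Binary.Reasoning.Setoid as SetoidReasoning

module _ {c ℓ} (R : CommutativeRing c ℓ) where
  open CommutativeRing R
  open SetoidReasoning setoid

  invertible-factor⇒divides : ∀ {u v d x y} → Invertible R u →
    u * d ≈ x → v * d ≈ y → Divides R x y
  invertible-factor⇒divides {u} {v} {d} {x} {y} (w , wu≈1) ud≈x vd≈y = v * w , (begin
    (v * w) * x        ≈⟨ *-congˡ (sym ud≈x) ⟩
    (v * w) * (u * d)  ≈⟨ *-assoc v w (u * d) ⟩
    v * (w * (u * d))  ≈⟨ *-congˡ (sym (*-assoc w u d)) ⟩
    v * ((w * u) * d)  ≈⟨ *-congˡ (*-congʳ wu≈1) ⟩
    v * (1# * d)       ≈⟨ *-congˡ (*-identityˡ d) ⟩
    v * d              ≈⟨ vd≈y ⟩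
    y                  ∎)

  ∈-resp-∣ : ∀ {J : Pred Carrier (c ⊔ ℓ)} → IsIdeal R J →
    ∀ {x y} → Divides R x y → J x → J y
  ∈-resp-∣ isJ (k , kx≈y) Jx = IsIdeal.∈-resp-≈ isJ kx≈y (IsIdeal.*-closed isJ k Jx)

  total-divisibility⇒valuation : ExcludedMiddle (c ⊔ ℓ) →
    (∀ x y → Divides R x y ⊎ Divides R y x) → IsValuationRing R
  total-divisibility⇒valuation em total J K isJ isK with em {J ⊆ K}
  ... | yes J⊆K = inj₁ J⊆K
  ... | no J⊈K = inj₂ λ {k} Kk → decidable-stable em λ k∉J →
    J⊈K λ {j} Jj → decidable-stable em λ j∉K →
      [ (λ j∣k → k∉J (∈-resp-∣ isJ j∣k Jj)) , (λ k∣j → j∉K (∈-resp-∣ isK k∣j Kk)) ]′ (total j k)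

module _ {c ℓ} (B : CommutativeRing c ℓ) where
  open CommutativeRing B
  open RingProperties ring using (-0#≈0#; x≈y⇒x∙y⁻¹≈ε; x∙y⁻¹≈ε⇒x≈y; [y-z]x≈yx-zx)
  open CommutativeSemigroupProperties +-commutativeSemigroup
    using () renaming (interchange to +-interchange)
  open CommutativeSemigroupProperties *-commutativeSemigroup
    using () renaming (interchange to *-interchange)
  open SetoidReasoning setoid

  Ideal : Set (Level.suc (c ⊔ ℓ))
  Ideal = Pred Carrier (c ⊔ ℓ)

  ComaximalIdeals : Ideal → Ideal → Set (c ⊔ ℓ)
  ComaximalIdeals J K = ∃₂ λ j k → J j × K k × j + k ≈ 1#

  ∈proper⇒¬invertible : ∀ {J x} → IsProperIdeal B J → J x → ¬ Invertible B x
  ∈proper⇒¬invertible (isJ , 1∉J) Jx (u , ux≈1) =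
    1∉J (IsIdeal.∈-resp-≈ isJ ux≈1 (IsIdeal.*-closed isJ u Jx))

  linear-combination-∈ : ∀ {J} → IsIdeal B J → ∀ s t {x y} → J x → J y → J (s * x + t * y)
  linear-combination-∈ isJ s t Jx Jy =
    IsIdeal.+-closed isJ (IsIdeal.*-closed isJ s Jx) (IsIdeal.*-closed isJ t Jy)

  ∈proper⇒¬comaximal : ∀ {J x y} → IsProperIdeal B J → J x → J y → ¬ Comaximal B x y
  ∈proper⇒¬comaximal (isJ , 1∉J) Jx Jy (s , t , sx+ty≈1) =
    1∉J (IsIdeal.∈-resp-≈ isJ sx+ty≈1 (linear-combination-∈ isJ s t Jx Jy))

  comaximal-∣ : ∀ {x y g} → Comaximal B x y → Divides B g x → Comaximal B g y
  comaximal-∣ {g = g} (s , t , sx+ty≈1) (k , kg≈x) =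
    s * k , t , trans (+-congʳ (trans (*-assoc s k g) (*-congˡ kg≈x))) sx+ty≈1

  comaximal⇒lcm : ∀ {x y m} → Comaximal B x y → m ≈ x * y → IsLcm B x y m
  comaximal⇒lcm {x} {y} {m} (s , t , sx+ty≈1) m≈xy =
    (y , trans (*-comm y x) (sym m≈xy)) , (x , sym m≈xy) , least
    where
    least : ∀ n → Divides B x n → Divides B y n → Divides B m n
    least n (k , kx≈n) (l , ly≈n) = s * l + t * k , (begin
      (s * l + t * k) * m                    ≈⟨ *-congˡ m≈xy ⟩
      (s * l + t * k) * (x * y)              ≈⟨ distribʳ (x * y) (s * l) (t * k) ⟩
      s * l * (x * y) + t * k * (x * y)      ≈⟨ +-cong (*-interchange s l x y) (*-congˡ (*-comm x y)) ⟩
      s * x * (l * y) + t * k * (y * x)      ≈⟨ +-cong (*-congˡ ly≈n) (*-interchange t k y x) ⟩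
      s * x * n + t * y * (k * x)            ≈⟨ +-congˡ (*-congˡ kx≈n) ⟩
      s * x * n + t * y * n                  ≈⟨ sym (distribʳ n (s * x) (t * y)) ⟩
      (s * x + t * y) * n                    ≈⟨ *-congʳ sx+ty≈1 ⟩
      1# * n                                 ≈⟨ *-identityˡ n ⟩
      n                                      ∎)

  factored-combination : ∀ {s t x y x' y' g} → s * x + t * y ≈ g → x' * g ≈ x → y' * g ≈ y →
    (s * x' + t * y') * g ≈ g
  factored-combination {s} {t} {x} {y} {x'} {y'} {g} sx+ty≈g x'g≈x y'g≈y = begin
    (s * x' + t * y') * g          ≈⟨ distribʳ g (s * x') (t * y') ⟩
    s * x' * g + t * y' * g        ≈⟨ +-cong (*-assoc s x' g) (*-assoc t y' g) ⟩
    s * (x' * g) + t * (y' * g)    ≈⟨ +-cong (*-congˡ x'g≈x) (*-congˡ y'g≈y) ⟩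
    s * x + t * y                  ≈⟨ sx+ty≈g ⟩
    g                              ∎

  _+⟨_⟩ : Ideal → Carrier → Ideal
  (J +⟨ x ⟩) z = ∃₂ λ j r → J j × j + r * x ≈ z

  +⟨⟩-isIdeal : ∀ {J} → IsIdeal B J → ∀ x → IsIdeal B (J +⟨ x ⟩)
  +⟨⟩-isIdeal isJ x = record
    { ∈-resp-≈ = λ { z≈z' (j , r , Jj , j+rx≈z) → j , r , Jj , trans j+rx≈z z≈z' }
    ; 0∈ = 0# , 0# , IsIdeal.0∈ isJ , trans (+-identityˡ (0# * x)) (zeroˡ x)
    ; +-closed = λ { (j , r , Jj , j+rx≈z) (j' , r' , Jj' , j'+r'x≈z') →
        j + j' , r + r' , IsIdeal.+-closed isJ Jj Jj' ,
        trans (+-congˡ (distribʳ x r r'))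
          (trans (+-interchange j j' (r * x) (r' * x)) (+-cong j+rx≈z j'+r'x≈z')) }
    ; *-closed = λ s → λ { (j , r , Jj , j+rx≈z) → s * j , s * r , IsIdeal.*-closed isJ s Jj ,
        trans (+-congˡ (*-assoc s r x)) (trans (sym (distribˡ s j (r * x))) (*-congˡ j+rx≈z)) }
    }

  ⊆+⟨⟩ : ∀ {J x} → J ⊆ J +⟨ x ⟩
  ⊆+⟨⟩ {x = x} {j} Jj = j , 0# , Jj , trans (+-congˡ (zeroˡ x)) (+-identityʳ j)

  ∈+⟨⟩ : ∀ {J} → IsIdeal B J → ∀ x → (J +⟨ x ⟩) x
  ∈+⟨⟩ isJ x = 0# , 1# , IsIdeal.0∈ isJ , trans (+-identityˡ (1# * x)) (*-identityˡ x)

  module _ {I : Ideal} (isI : IsIdeal B I) where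
    open QuotientConstruction B I isI using (_≈ᴵ_; lift)
    private module B/I = CommutativeRing (B / (I , isI))

    ∈⇒≈ᴵ0 : ∀ {m} → I m → m ≈ᴵ 0#
    ∈⇒≈ᴵ0 {m} Im = IsIdeal.∈-resp-≈ isI (sym (trans (+-congˡ -0#≈0#) (+-identityʳ m))) Im

    ∈-summand⇒≈ᴵ : ∀ {m y z} → I m → m + y ≈ z → y ≈ᴵ z
    ∈-summand⇒≈ᴵ {y = y} Im m+y≈z =
      B/I.trans (B/I.sym (B/I.+-identityˡ y))
        (B/I.trans (B/I.+-congʳ (B/I.sym (∈⇒≈ᴵ0 Im))) (lift m+y≈z))

  module Bezout (isBezout : IsBezout B) where
    gcd : Carrier → Carrier → Carrier
    gcd x y = proj₁ (isBezout x y)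

    gcd∣ˡ : ∀ x y → Divides B (gcd x y) x
    gcd∣ˡ x y = proj₁ (proj₂ (isBezout x y) x)
      (1# , 0# , trans (+-cong (*-identityˡ x) (zeroˡ y)) (+-identityʳ x))

    gcd∣ʳ : ∀ x y → Divides B (gcd x y) y
    gcd∣ʳ x y = proj₁ (proj₂ (isBezout x y) y)
      (0# , 1# , trans (+-cong (zeroˡ x) (*-identityˡ y)) (+-identityˡ y))

    gcd-linear-combination : ∀ x y → ∃₂ λ s t → s * x + t * y ≈ gcd x y
    gcd-linear-combination x y = proj₂ (proj₂ (isBezout x y) (gcd x y)) (1# , *-identityˡ (gcd x y))

    invertible-gcd⇒comaximal : ∀ {x y} → Invertible B (gcd x y) → Comaximal B x y
    invertible-gcd⇒comaximal {x} {y} = proj₂ (proj₂ (isBezout x y) 1#)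

    gcd-∈ : ∀ {J x y} → IsIdeal B J → J x → J y → J (gcd x y)
    gcd-∈ {x = x} {y} isJ Jx Jy with gcd-linear-combination x y
    ... | s , t , sx+ty≈g = IsIdeal.∈-resp-≈ isJ sx+ty≈g (linear-combination-∈ isJ s t Jx Jy)

  module _ (isDomain : IsDomain B) where
    cancel-domain : ∀ {u d} → u * d ≈ d → u ≈ 1# ⊎ d ≈ 0#
    cancel-domain {u} {d} ud≈d with proj₂ isDomain (u - 1#) d
      (trans ([y-z]x≈yx-zx d u 1#) (x≈y⇒x∙y⁻¹≈ε (trans ud≈d (sym (*-identityˡ d)))))
    ... | inj₁ u-1≈0 = inj₁ (x∙y⁻¹≈ε⇒x≈y u 1# u-1≈0)
    ... | inj₂ d≈0 = inj₂ d≈0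

    module _ (isBezout : IsBezout B) where
      open Bezout isBezout

      comaximal-cofactors : ∀ x y → ∃ λ d → ∃₂ λ x' y' →
        Comaximal B x' y' × x' * d ≈ x × y' * d ≈ y
      comaximal-cofactors x y with gcd∣ˡ x y | gcd∣ʳ x y | gcd-linear-combination x y
      ... | x' , x'g≈x | y' , y'g≈y | s , t , sx+ty≈g
        with cancel-domain (factored-combination sx+ty≈g x'g≈x y'g≈y)
      ... | inj₁ sx'+ty'≈1 = gcd x y , x' , y' , (s , t , sx'+ty'≈1) , x'g≈x , y'g≈y
      ... | inj₂ g≈0 = 0# , 1# , 0# ,
        (1# , 0# , trans (+-cong (*-identityˡ 1#) (zeroˡ 0#)) (+-identityʳ 1#)) ,
        trans (zeroʳ 1#) (sym (vanishes x'g≈x)) , trans (zeroʳ 0#) (sym (vanishes y'g≈y))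
        where
        vanishes : ∀ {z z'} → z' * gcd x y ≈ z → z ≈ 0#
        vanishes {z' = z'} z'g≈z = trans (sym z'g≈z) (trans (*-congˡ g≈0) (zeroʳ z'))

  module _ (em : ExcludedMiddle (c ⊔ ℓ)) where

    ¬comaximal⇒⊆maximal : ∀ {J M} → IsIdeal B J → IsMaximalIdeal B M →
      ¬ ComaximalIdeals J M → J ⊆ M
    ¬comaximal⇒⊆maximal {M = M} isJ ((isM , _) , maximal) ¬JM {x} Jx with em {(M +⟨ x ⟩) 1#}
    ... | yes (m , r , Mm , m+rx≈1) =
      ⊥-elim (¬JM (r * x , m , IsIdeal.*-closed isJ r Jx , Mm , trans (+-comm (r * x) m) m+rx≈1))
    ... | no 1∉M+x = maximal (M +⟨ x ⟩) (+⟨⟩-isIdeal isM x , 1∉M+x) ⊆+⟨⟩ (∈+⟨⟩ isM x)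

    weakly-prime⇒lcm-factor-∈ : ∀ {I a b m} → IsWeaklyPrime B I → IsLcm B a b m → I m → I a ⊎ I b
    weakly-prime⇒lcm-factor-∈ {I} {a} {b} {m} (_ , lcm-closed) m-lcm Im with em {I a} | em {I b}
    ... | yes Ia | _      = inj₁ Ia
    ... | no _   | yes Ib = inj₂ Ib
    ... | no a∉I | no b∉I = ⊥-elim (lcm-closed a b m m-lcm a∉I b∉I Im)

    ∉unique-maximal⇒invertible-mod : KrullProperty B → ∀ {I M : Ideal} (isI : IsIdeal B I) →
      (∀ M' → IsMaximalIdeal B M' → I ⊆ M' → M' ⊆ M) →
      ∀ {r} → ¬ M r → Invertible (B / (I , isI)) r
    ∉unique-maximal⇒invertible-mod krull {I} isI unique {r} r∉M with em {(I +⟨ r ⟩) 1#}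
    ... | yes (i , u , Ii , i+ur≈1) = u , ∈-summand⇒≈ᴵ isI Ii i+ur≈1
    ... | no 1∉I+r with krull (I +⟨ r ⟩) (+⟨⟩-isIdeal isI r , 1∉I+r)
    ...   | M' , maximal-M' , I+r⊆M' =
      ⊥-elim (r∉M (unique M' maximal-M' (λ Ii → I+r⊆M' (⊆+⟨⟩ Ii)) (I+r⊆M' (∈+⟨⟩ isI r))))

    module _ (isDomain : IsDomain B) (isBezout : IsBezout B) (krull : KrullProperty B)
             {I M : Ideal} (isI : IsIdeal B I) (proper-M : IsProperIdeal B M)
             (unique : ∀ M' → IsMaximalIdeal B M' → I ⊆ M' → M' ⊆ M) where
      open QuotientConstruction B I isI using (lift)

      unique-maximal⇒total-divisibility-mod : ∀ x y →
        Divides (B / (I , isI)) x y ⊎ Divides (B / (I , isI)) y x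
      unique-maximal⇒total-divisibility-mod x y with comaximal-cofactors isDomain isBezout x y
      ... | d , x' , y' , x'y'-comaximal , x'd≈x , y'd≈y with em {M x'}
      ... | no x'∉M = inj₁ (invertible-factor⇒divides (B / (I , isI))
              (∉unique-maximal⇒invertible-mod krull isI unique x'∉M) (lift x'd≈x) (lift y'd≈y))
      ... | yes x'∈M = inj₂ (invertible-factor⇒divides (B / (I , isI))
              (∉unique-maximal⇒invertible-mod krull isI unique y'∉M) (lift y'd≈y) (lift x'd≈x))
        where
        y'∉M : ¬ M y'
        y'∉M y'∈M = ∈proper⇒¬comaximal proper-M x'∈M y'∈M x'y'-comaximal

    module _ (isBezout : IsBezout B) (isAdequate : IsAdequate B) where
      open Bezout isBezout

      record AdequateSplitting (a b : Carrier) : Set (c ⊔ ℓ) where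
        field
          left right           : Carrier
          factorization        : a ≈ left * right
          comaximal-factors    : Comaximal B left right
          left-comaximal       : Comaximal B left b
          right-divisors-meet  : ∀ e → Divides B e right → ¬ Invertible B e → ¬ Comaximal B e b

      adequate-splitting : ∀ {a b} → ¬ a ≈ 0# → ¬ Invertible B a → ¬ b ≈ 0# → ¬ Invertible B b →
        AdequateSplitting a b
      adequate-splitting {a} {b} a≉0 a-nonunit b≉0 b-nonunit
        with isAdequate a b a≉0 a-nonunit b≉0 b-nonunit
      ... | x , y , a≈xy , gcd-xb-1 , divisors-meet = record
        { factorization = a≈xy
        ; comaximal-factors = invertible-gcd⇒comaximal (decidable-stable em λ g-nonunit →
            divisors-meet (gcd x y) (gcd∣ʳ x y) g-nonunit (comaximal-∣ x-comaximal (gcd∣ˡ x y)))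
        ; left-comaximal = x-comaximal
        ; right-divisors-meet = divisors-meet
        }
        where
        x-comaximal : Comaximal B x b
        x-comaximal = invertible-gcd⇒comaximal (gcd-xb-1 (gcd x b) (gcd∣ˡ x b) (gcd∣ʳ x b))

      weakly-prime⇒overideals-not-comaximal : ∀ {I J K} → IsWeaklyPrime B I → NonzeroIdeal B I →
        IsProperIdeal B J → IsProperIdeal B K → I ⊆ J → I ⊆ K → ¬ ComaximalIdeals J K
      weakly-prime⇒overideals-not-comaximal {I = I} wp (a , Ia , a≉0) proper-J proper-K I⊆J I⊆K
        (j , k , Jj , Kk , j+k≈1) =
        [ left∉I , right∉I ]′
          (weakly-prime⇒lcm-factor-∈ wp (comaximal⇒lcm comaximal-factors factorization) Ia)
        where
        j≉0 : ¬ j ≈ 0#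
        j≉0 j≈0 = proj₂ proper-K (IsIdeal.∈-resp-≈ (proj₁ proper-K)
          (trans (sym (+-identityˡ k)) (trans (+-congʳ (sym j≈0)) j+k≈1)) Kk)

        open AdequateSplitting (adequate-splitting a≉0 (∈proper⇒¬invertible (proj₁ wp) Ia)
                                                   j≉0 (∈proper⇒¬invertible proper-J Jj))

        left∉I : ¬ I left
        left∉I I-left = ∈proper⇒¬comaximal proper-J (I⊆J I-left) Jj left-comaximal

        right∉I : ¬ I right
        right∉I I-right = right-divisors-meet (gcd right k) (gcd∣ˡ right k)
          (∈proper⇒¬invertible proper-K (gcd-∈ (proj₁ proper-K) (I⊆K I-right) Kk))
          (comaximal-∣ (1# , 1# , trans (+-cong (*-identityˡ k) (*-identityˡ j)) (trans (+-comm k j) j+k≈1))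
                       (gcd∣ʳ right k))

      weakly-prime⇒maximal-overideal-⊆ : ∀ {I M₁ M₂} → IsWeaklyPrime B I → NonzeroIdeal B I →
        IsMaximalIdeal B M₁ → IsMaximalIdeal B M₂ → I ⊆ M₁ → I ⊆ M₂ → M₁ ⊆ M₂
      weakly-prime⇒maximal-overideal-⊆ wp nonzero (proper₁ , _) maximal₂ I⊆M₁ I⊆M₂ =
        ¬comaximal⇒⊆maximal (proj₁ proper₁) maximal₂
          (weakly-prime⇒overideals-not-comaximal wp nonzero proper₁ (proj₁ maximal₂) I⊆M₁ I⊆M₂)

lemma3p3 : ∀ {c ℓ} → ExcludedMiddle (c ⊔ ℓ) →
    (B : CommutativeRing c ℓ) → KrullProperty B →
    IsAdequateBezoutDomain B →
    (I : Pred (CommutativeRing.Carrier B) (c ⊔ ℓ)) →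
    (wp : IsWeaklyPrime B I) → NonzeroIdeal B I →
    (∃ λ M → IsMaximalIdeal B M × I ⊆ M ×
       (∀ M' → IsMaximalIdeal B M' → I ⊆ M' → M' ⊆ M × M ⊆ M'))
    × IsValuationRing (B / (I , proj₁ (proj₁ wp)))
lemma3p3 em B krull (isDomain , isBezout , isAdequate) I wp nonzero with krull I (proj₁ wp)
... | M , maximal-M , I⊆M =
  (M , maximal-M , I⊆M , λ M' maximal-M' I⊆M' → ⊆M M' maximal-M' I⊆M' , M⊆ M' maximal-M' I⊆M') ,
  total-divisibility⇒valuation (B / (I , proj₁ (proj₁ wp))) em
    (unique-maximal⇒total-divisibility-mod B em isDomain isBezout krull
      (proj₁ (proj₁ wp)) (proj₁ maximal-M) ⊆M)
  where
  ⊆M : ∀ M' → IsMaximalIdeal B M' → I ⊆ M' → M' ⊆ M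
  ⊆M M' maximal-M' I⊆M' =
    weakly-prime⇒maximal-overideal-⊆ B em isBezout isAdequate wp nonzero maximal-M' maximal-M I⊆M' I⊆M

  M⊆ : ∀ M' → IsMaximalIdeal B M' → I ⊆ M' → M ⊆ M'
  M⊆ M' maximal-M' I⊆M' =
    weakly-prime⇒maximal-overideal-⊆ B em isBezout isAdequate wp nonzero maximal-M maximal-M' I⊆M I⊆M'
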